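{- For every integer $k\ge2$, $B_k$ is an ACB graph with $\nabla_{B_k}(X_k)=k$ and $\nabla_{B_k}(Y_k)=2$.
   Context: For $k\ge 2$, $B_k$ is the bipartite graph with color classes $X_k=\{x_1,\dots,x_k\}$ and $Y_k=\{y_1,\dots,y_{2k-2}\}$ in which $N(x_i)=\{y_i,y_{i+1},\dots,y_{i+k-2}\}$ for $i=1,\dots,k$. For a bipartite graph $B=(X,Y,E)$: the mirror $mir(B)$ has the same color classes and $xy$ ($x\in X$, $y\in Y$) is an edge iff it is not an edge of $B$; $B$ is chordal bipartite if it has no induced chordless cycle $C_{2k}$, $k\ge3$; $B$ is ACB if both $B$ and $mir(B)$ are chordal bipartite. $\nabla_B(X)$ is the maximum number of vertices of $X$ whose neighborhoods are pairwise incomparable under set inclusion (equal neighborhoods count as comparable); $\nabla_B(Y)$ analogously. -}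

module Defs where

open import Data.Nat using (ℕ; zero; suc; _+_; _*_; _∸_; _≤_; _≤ᵇ_)
open import Data.Fin using (Fin; toℕ)
open import Data.Bool using (Bool; true; false; not; _∧_; T)
open import Data.Product using (Σ; _×_; _,_)
open import Data.Sum using (_⊎_)
open import Relation.Binary.PropositionalEquality using (_≡_; _≢_)
open import Relation.Nullary using (¬_)
open import Function.Definitions using (Injective)

-- A bipartite graph with colour classes X = Fin m and Y = Fin n,
-- given by its (decidable) biadjacency relation  adj x y  (x ∈ X, y ∈ Y).
record BipGraph (m n : ℕ) : Set where
  constructor bip
  field
    adj : Fin m → Fin n → Bool
open BipGraph public

Edge : ∀ {m n} → BipGraph m n → Fin m → Fin n → Set
Edge B x y = T (adj B x y)

mir : ∀ {m n} → BipGraph m n → BipGraph m n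
mir B = bip (λ x y → not (adj B x y))

-- Cyclic pattern of a cycle x₀ y₀ x₁ y₁ … x_{ℓ-1} y_{ℓ-1} x₀ with ℓ = 3 + r:
-- x_i is adjacent exactly to y_i and y_{i-1} (indices mod ℓ).
CycAdj : (r : ℕ) → Fin (3 + r) → Fin (3 + r) → Set
CycAdj r i j = (toℕ j ≡ toℕ i) ⊎ (suc (toℕ j) ≡ toℕ i) ⊎ ((toℕ i ≡ 0) × (toℕ j ≡ 2 + r))

-- An induced chordless cycle C_{2ℓ}, ℓ = 3 + r ≥ 3: distinct vertices
-- a i ∈ X, b j ∈ Y such that the edges between them are exactly the cycle edges.
InducedCycle : ∀ {m n} → BipGraph m n → (r : ℕ) → Set
InducedCycle {m} {n} B r =
  Σ (Fin (3 + r) → Fin m) λ a → Σ (Fin (3 + r) → Fin n) λ b →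
    Injective _≡_ _≡_ a × Injective _≡_ _≡_ b ×
    (∀ i j → (Edge B (a i) (b j) → CycAdj r i j) × (CycAdj r i j → Edge B (a i) (b j)))

ChordalBipartite : ∀ {m n} → BipGraph m n → Set
ChordalBipartite B = ∀ r → ¬ InducedCycle B r

ACB : ∀ {m n} → BipGraph m n → Set
ACB B = ChordalBipartite B × ChordalBipartite (mir B)

transpose : ∀ {m n} → BipGraph m n → BipGraph n m
transpose B = bip (λ y x → adj B x y)

NSub : ∀ {m n} → BipGraph m n → Fin m → Fin m → Set
NSub {m} {n} B u v = (y : Fin n) → Edge B u y → Edge B v y

-- t vertices of X with pairwise incomparable neighbourhoods
-- (equal neighbourhoods count as comparable)
IncompFamily : ∀ {m n} → BipGraph m n → (t : ℕ) → Set
IncompFamily {m} B t =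
  Σ (Fin t → Fin m) λ a → ∀ i j → i ≢ j → ¬ NSub B (a i) (a j)

NablaX : ∀ {m n} → BipGraph m n → ℕ → Set
NablaX B t = IncompFamily B t × (∀ s → IncompFamily B s → s ≤ t)

NablaY : ∀ {m n} → BipGraph m n → ℕ → Set
NablaY B t = NablaX (transpose B) t

-- B_k (0-indexed): X = {x₀,…,x_{k-1}}, Y = {y₀,…,y_{2k-3}},
-- N(x_i) = {y_i, …, y_{i+k-2}}.
Bk : (k : ℕ) → BipGraph k (2 * k ∸ 2)
Bk k = bip (λ i j → (toℕ i ≤ᵇ toℕ j) ∧ (toℕ j ≤ᵇ toℕ i + (k ∸ 2)))

module Submission where

-- B_k (k = 2 + c) is an interval graph: x_i is adjacent to y_j iff i ≤ j ≤ i + c.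
--
-- The route to ACB goes through a general fact about arbitrary bipartite graphs:
-- if no three vertices of Y have pairwise incomparable neighbourhoods
-- (∇(Y) ≤ 2), the graph is ACB.  Indeed, the Y-vertices of an induced cycle
-- C_{2ℓ} (ℓ ≥ 3) have pairwise incomparable neighbourhoods: if N(y_i) ⊆ N(y_j)
-- then the two cycle neighbours of y_i would both see y_j, creating a chord
-- (two cycle X-vertices sharing two cycle Y-neighbours).  Complementation
-- reverses inclusion, so the mirror has the same incomparable families of Y
-- and is therefore chordal bipartite as well.
--
-- For B_k itself: ∇(X) = k because the neighbourhood intervals [i, i+c] are
-- pairwise incomparable, while any incomparable family is injective.
-- ∇(Y) = 2: N(y_0) = {x_0} and N(y_{2c+1}) = {x_{c+1}} are incomparable, and the
-- neighbourhoods of Y-vertices with index ≤ c form a chain (prefixes of X), as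
-- do those with index > c (suffixes of X), so by pigeonhole any three
-- Y-vertices contain a comparable pair.

open import Defs
open import Data.Nat using (ℕ; _≤_; zero; suc; _+_; _*_; _∸_; _<_; z≤n; s≤s; s≤s⁻¹)
open import Data.Nat.Properties
open import Data.Fin using (Fin; toℕ; fromℕ; fromℕ<) renaming (zero to fzero; suc to fsuc)
open import Data.Fin.Properties using (toℕ-injective; toℕ<n; toℕ-fromℕ; toℕ-fromℕ<; injective⇒≤)
  renaming (_≟_ to _≟ᶠ_)
open import Data.Bool using (true; false; not; T)
open import Data.Bool.Properties using (T-∧)
open import Data.Product using (_×_; Σ; _,_; proj₁; proj₂)
open import Data.Sum using (_⊎_; inj₁; inj₂)
open import Data.Empty using (⊥; ⊥-elim)
open import Function.Bundles using (Equivalence)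
open import Relation.Binary.PropositionalEquality using (_≡_; _≢_; refl; sym; trans; cong; subst; subst₂)
open import Relation.Nullary using (¬_; yes; no)
open import Relation.Binary using (tri<; tri≈; tri>)

cycPred : ℕ → ℕ → ℕ
cycPred r zero    = suc (suc r)
cycPred r (suc i) = i

cycAdj-cases : ∀ r {i j : Fin (3 + r)} → CycAdj r i j →
               toℕ j ≡ toℕ i ⊎ toℕ j ≡ cycPred r (toℕ i)
cycAdj-cases r (inj₁ j≡i)               = inj₁ j≡i
cycAdj-cases r (inj₂ (inj₁ 1+j≡i))      = inj₂ (cong (cycPred r) 1+j≡i)
cycAdj-cases r (inj₂ (inj₂ (i≡0 , j≡))) = inj₂ (trans j≡ (sym (cong (cycPred r) i≡0)))

cycPred²≢id : ∀ r i → cycPred r (cycPred r i) ≢ i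
cycPred²≢id r zero          ()
cycPred²≢id r (suc zero)    ()
cycPred²≢id r (suc (suc i)) e = <⇒≢ (m<n+m i {2} (s≤s z≤n)) e

-- Two distinct X-vertices of the cycle share at most one Y-neighbour:
-- their neighbour pairs {p, p⁻} and {q, q⁻} would otherwise coincide,
-- forcing p = q⁻ and q = p⁻, i.e. p⁻⁻ = p.
noCommonPair : ∀ r {p q j₁ j₂ : Fin (3 + r)} → p ≢ q → j₁ ≢ j₂ →
               CycAdj r p j₁ → CycAdj r p j₂ → CycAdj r q j₁ → CycAdj r q j₂ → ⊥
noCommonPair r {p} {q} {j₁} {j₂} p≢q j₁≢j₂ pj₁ pj₂ qj₁ qj₂ =
  go (cycAdj-cases r pj₁) (cycAdj-cases r pj₂) (cycAdj-cases r qj₁) (cycAdj-cases r qj₂)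
  where
  P = toℕ p
  Q = toℕ q
  J₁ = toℕ j₁
  J₂ = toℕ j₂
  js : J₁ ≢ J₂
  js e = j₁≢j₂ (toℕ-injective e)
  pq : P ≢ Q
  pq e = p≢q (toℕ-injective e)
  swapped : P ≡ cycPred r Q → Q ≡ cycPred r P → ⊥
  swapped p≡q⁻ q≡p⁻ = cycPred²≢id r P (trans (cong (cycPred r) (sym q≡p⁻)) (sym p≡q⁻))
  go : J₁ ≡ P ⊎ J₁ ≡ cycPred r P → J₂ ≡ P ⊎ J₂ ≡ cycPred r P →
       J₁ ≡ Q ⊎ J₁ ≡ cycPred r Q → J₂ ≡ Q ⊎ J₂ ≡ cycPred r Q → ⊥
  go (inj₁ a) (inj₁ b) _ _ = js (trans a (sym b))
  go (inj₂ a) (inj₂ b) _ _ = js (trans a (sym b))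
  go _ _ (inj₁ a) (inj₁ b) = js (trans a (sym b))
  go _ _ (inj₂ a) (inj₂ b) = js (trans a (sym b))
  go (inj₁ a) (inj₂ b) (inj₁ c) (inj₂ d) = pq (trans (sym a) c)
  go (inj₂ a) (inj₁ b) (inj₂ c) (inj₁ d) = pq (trans (sym b) d)
  go (inj₁ a) (inj₂ b) (inj₂ c) (inj₁ d) = swapped (trans (sym a) c) (trans (sym d) b)
  go (inj₂ a) (inj₁ b) (inj₁ c) (inj₂ d) = swapped (trans (sym b) d) (trans (sym c) a)

otherNeighbour : ∀ r (j : Fin (3 + r)) → Σ (Fin (3 + r)) λ q → CycAdj r q j × q ≢ j
otherNeighbour r j with toℕ j ≟ suc (suc r)
... | yes j≡last = fzero , inj₂ (inj₂ (refl , j≡last)) , λ 0≡j → 0≢1+n (trans (cong toℕ 0≡j) j≡last)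
... | no j≢last  = fromℕ< j+1<ℓ , inj₂ (inj₁ (sym (toℕ-fromℕ< j+1<ℓ))) ,
                   λ e → 1+n≢n (trans (sym (toℕ-fromℕ< j+1<ℓ)) (cong toℕ e))
  where
  j+1<ℓ : suc (toℕ j) < 3 + r
  j+1<ℓ = s≤s (≤∧≢⇒< (s≤s⁻¹ (toℕ<n j)) j≢last)

cycle⇒incomparableY : ∀ {m n} {B : BipGraph m n} {r} → InducedCycle B r →
                      IncompFamily (transpose B) (3 + r)
cycle⇒incomparableY {B = B} {r} (a , b , _ , _ , adjacency) = b , incomparable
  where
  sound : ∀ i j → Edge B (a i) (b j) → CycAdj r i j
  sound i j = proj₁ (adjacency i j)
  complete : ∀ i j → CycAdj r i j → Edge B (a i) (b j)
  complete i j = proj₂ (adjacency i j)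
  -- N(y_i) ⊆ N(y_j) makes x_i and x_{i+1} both adjacent to y_i and y_j
  incomparable : ∀ i j → i ≢ j → ¬ NSub (transpose B) (b i) (b j)
  incomparable i j i≢j sub with otherNeighbour r i
  ... | q , qi , q≢i =
    noCommonPair r (λ e → q≢i (sym e)) i≢j (inj₁ refl)
      (sound i j (sub (a i) (complete i i (inj₁ refl))))
      qi
      (sound q j (sub (a q) (complete q i qi)))

mir-reverses : ∀ {m n} {B : BipGraph m n} {u v} → NSub B u v → NSub (mir B) v u
mir-reverses sub y = contrapositive (sub y)
  where
  contrapositive : ∀ {s t} → (T s → T t) → T (not t) → T (not s)
  contrapositive {false}          _   _  = _
  contrapositive {true}  {true}  _   ()
  contrapositive {true}  {false} s⇒t _  = s⇒t _

incomparable-mir : ∀ {m n} {B : BipGraph m n} {s} → IncompFamily (mir B) s → IncompFamily B s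
incomparable-mir {B = B} (f , inc) = f , λ i j i≢j sub → inc j i (λ e → i≢j (sym e)) (mir-reverses {B = B} sub)

-- Incomparable vertices are distinct, so ∇(X) ≤ |X|.
incomparable≤size : ∀ {m n} {B : BipGraph m n} {s} → IncompFamily B s → s ≤ m
incomparable≤size {B = B} (f , inc) = injective⇒≤ injective
  where
  injective : ∀ {i j} → f i ≡ f j → i ≡ j
  injective {i} {j} fi≡fj with i ≟ᶠ j
  ... | yes i≡j = i≡j
  ... | no  i≢j = ⊥-elim (inc i j i≢j (λ y e → subst (λ x → Edge B x y) fi≡fj e))

Comparable : ∀ {m n} → BipGraph m n → Fin m → Fin m → Set
Comparable B u v = NSub B u v ⊎ NSub B v u

incomparablePair : ∀ {m n} {B : BipGraph m n} {s} (family : IncompFamily B s) {i j} →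
                   i ≢ j → ¬ Comparable B (proj₁ family i) (proj₁ family j)
incomparablePair (_ , inc) i≢j (inj₁ sub) = inc _ _ i≢j sub
incomparablePair (_ , inc) i≢j (inj₂ sub) = inc _ _ (λ e → i≢j (sym e)) sub

comparableTriples⇒≤2 : ∀ {m n} {B : BipGraph m n} →
  (∀ u v w → Comparable B u v ⊎ Comparable B u w ⊎ Comparable B v w) →
  ∀ s → IncompFamily B s → s ≤ 2
comparableTriples⇒≤2 triple zero                _ = z≤n
comparableTriples⇒≤2 triple (suc zero)          _ = s≤s z≤n
comparableTriples⇒≤2 triple (suc (suc zero))    _ = ≤-refl
comparableTriples⇒≤2 {B = B} triple (suc (suc (suc s))) family@(f , _)
  with triple (f fzero) (f (fsuc fzero)) (f (fsuc (fsuc fzero)))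
... | inj₁ c        = ⊥-elim (incomparablePair {B = B} family (λ ()) c)
... | inj₂ (inj₁ c) = ⊥-elim (incomparablePair {B = B} family (λ ()) c)
... | inj₂ (inj₂ c) = ⊥-elim (incomparablePair {B = B} family (λ ()) c)

-- ∇(Y) ≤ 2 forces ACB: an induced cycle in B or in its mirror would give
-- at least three Y-vertices with pairwise incomparable neighbourhoods in B.
narrowY⇒ACB : ∀ {m n} (B : BipGraph m n) → (∀ s → IncompFamily (transpose B) s → s ≤ 2) → ACB B
narrowY⇒ACB B bound =
  (λ r cycle → 3+r≰2 (bound _ (cycle⇒incomparableY {B = B} cycle))) ,
  (λ r cycle → 3+r≰2 (bound _ (incomparable-mir {B = transpose B} (cycle⇒incomparableY {B = mir B} cycle))))
  where
  3+r≰2 : ∀ {r} → ¬ (3 + r ≤ 2)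
  3+r≰2 (s≤s (s≤s ()))

-- Adjacency of B_{2+c} in terms of indices.
Interval : ℕ → ℕ → ℕ → Set
Interval c i j = i ≤ j × j ≤ i + c

-- Y-neighbourhoods of low indices (≤ c) are prefixes of X, hence nested.
low-nested : ∀ {c u v i} → u ≤ v → v ≤ c → Interval c i u → Interval c i v
low-nested {c} {i = i} u≤v v≤c (i≤u , _) = ≤-trans i≤u u≤v , ≤-trans v≤c (m≤n+m c i)

-- Y-neighbourhoods of high indices (> c) are suffixes of X = {0, …, 1 + c}.
high-nested : ∀ {c u v i} → v ≤ u → c < v → i ≤ suc c → Interval c i u → Interval c i v
high-nested v≤u c<v i≤1+c (_ , u≤i+c) = ≤-trans i≤1+c c<v , ≤-trans v≤u u≤i+c

data SameSide (c u v : ℕ) : Set where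
  low  : u ≤ c → v ≤ c → SameSide c u v
  high : c < u → c < v → SameSide c u v

pigeonhole : ∀ c u v w → SameSide c u v ⊎ SameSide c u w ⊎ SameSide c v w
pigeonhole c u v w with u ≤? c | v ≤? c | w ≤? c
... | yes u≤ | yes v≤ | _      = inj₁ (low u≤ v≤)
... | no  u> | no  v> | _      = inj₁ (high (≰⇒> u>) (≰⇒> v>))
... | yes u≤ | no  _  | yes w≤ = inj₂ (inj₁ (low u≤ w≤))
... | yes _  | no  v> | no  w> = inj₂ (inj₂ (high (≰⇒> v>) (≰⇒> w>)))
... | no  _  | yes v≤ | yes w≤ = inj₂ (inj₂ (low v≤ w≤))
... | no  u> | yes _  | no  w> = inj₂ (inj₁ (high (≰⇒> u>) (≰⇒> w>)))

-- The graph B_k for k = 2 + c, with X = {x_0, …, x_{c+1}} and Y = {y_0, …, y_{2c+1}}.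
module IntervalGraph (c : ℕ) where

  k : ℕ
  k = suc (suc c)

  n : ℕ
  n = 2 * k ∸ 2

  B : BipGraph k n
  B = Bk k

  edge→interval : ∀ {x y} → Edge B x y → Interval c (toℕ x) (toℕ y)
  edge→interval {x} {y} e with Equivalence.to T-∧ e
  ... | x≤y , y≤x+c = ≤ᵇ⇒≤ (toℕ x) (toℕ y) x≤y , ≤ᵇ⇒≤ (toℕ y) (toℕ x + c) y≤x+c

  interval→edge : ∀ {x y} → Interval c (toℕ x) (toℕ y) → Edge B x y
  interval→edge (x≤y , y≤x+c) = Equivalence.from T-∧ (≤⇒≤ᵇ x≤y , ≤⇒≤ᵇ y≤x+c)

  x-bound : (x : Fin k) → toℕ x ≤ suc c
  x-bound x = s≤s⁻¹ (toℕ<n x)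

  n≡ : n ≡ suc (suc c + c)
  n≡ rewrite +-identityʳ c | +-suc c (suc c) | +-suc c c = refl

  yAt : (t : ℕ) → t ≤ suc c + c → Fin n
  yAt t t≤ = fromℕ< (subst (t <_) (sym n≡) (s≤s t≤))

  toℕ-yAt : ∀ t (t≤ : t ≤ suc c + c) → toℕ (yAt t t≤) ≡ t
  toℕ-yAt t t≤ = toℕ-fromℕ< _

  separatedBy : ∀ {x x′ : Fin k} t → t ≤ suc c + c →
                Interval c (toℕ x) t → ¬ Interval c (toℕ x′) t → ¬ NSub B x x′
  separatedBy {x} {x′} t t≤ inX notInX′ sub =
    notInX′ (subst (Interval c (toℕ x′)) (toℕ-yAt t t≤)
              (edge→interval (sub y (interval→edge (subst (Interval c (toℕ x)) (sym (toℕ-yAt t t≤)) inX)))))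
    where
    y = yAt t t≤

  -- The intervals [i, i+c] are pairwise incomparable: y_i separates x_i from
  -- any x_j with j > i, and y_{i+c} from any x_j with j < i.
  incomparableX : ∀ i j → i ≢ j → ¬ NSub B i j
  incomparableX i j i≢j with <-cmp (toℕ i) (toℕ j)
  ... | tri< i<j _ _ = separatedBy (toℕ i) (≤-trans (x-bound i) (m≤m+n (suc c) c))
                         (≤-refl , m≤m+n (toℕ i) c) (λ (j≤i , _) → <⇒≱ i<j j≤i)
  ... | tri≈ _ i≡j _ = λ _ → i≢j (toℕ-injective i≡j)
  ... | tri> _ _ j<i = separatedBy (toℕ i + c) (+-monoˡ-≤ c (x-bound i))
                         (m≤m+n (toℕ i) c , ≤-refl) (λ (_ , i+c≤j+c) → <⇒≱ (+-monoˡ-< c j<i) i+c≤j+c)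

  nablaX : NablaX B k
  nablaX = ((λ x → x) , incomparableX) , λ s → incomparable≤size {B = B}

  sameSide⇒comparable : ∀ (u v : Fin n) → SameSide c (toℕ u) (toℕ v) → Comparable (transpose B) u v
  sameSide⇒comparable u v (low u≤c v≤c) with ≤-total (toℕ u) (toℕ v)
  ... | inj₁ u≤v = inj₁ λ x e → interval→edge (low-nested u≤v v≤c (edge→interval e))
  ... | inj₂ v≤u = inj₂ λ x e → interval→edge (low-nested v≤u u≤c (edge→interval e))
  sameSide⇒comparable u v (high c<u c<v) with ≤-total (toℕ u) (toℕ v)
  ... | inj₁ u≤v = inj₂ λ x e → interval→edge (high-nested u≤v c<u (x-bound x) (edge→interval e))
  ... | inj₂ v≤u = inj₁ λ x e → interval→edge (high-nested v≤u c<v (x-bound x) (edge→interval e))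

  comparableTriplesY : ∀ u v w → Comparable (transpose B) u v ⊎ Comparable (transpose B) u w ⊎ Comparable (transpose B) v w
  comparableTriplesY u v w with pigeonhole c (toℕ u) (toℕ v) (toℕ w)
  ... | inj₁ uv        = inj₁ (sameSide⇒comparable u v uv)
  ... | inj₂ (inj₁ uw) = inj₂ (inj₁ (sameSide⇒comparable u w uw))
  ... | inj₂ (inj₂ vw) = inj₂ (inj₂ (sameSide⇒comparable v w vw))

  -- N(y_0) = {x_0} and N(y_{2c+1}) = {x_{c+1}} are incomparable.
  yFirst yLast : Fin n
  yFirst = yAt 0 z≤n
  yLast  = yAt (suc c + c) ≤-refl

  xLast : Fin k
  xLast = fromℕ (suc c)

  extremeY : Fin 2 → Fin n
  extremeY fzero    = yFirst
  extremeY (fsuc _) = yLast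

  incomparableY : ∀ i j → i ≢ j → ¬ NSub (transpose B) (extremeY i) (extremeY j)
  incomparableY fzero        fzero        i≢j _   = i≢j refl
  incomparableY (fsuc fzero) (fsuc fzero) i≢j _   = i≢j refl
  -- x_0 sees y_0 but not y_{2c+1}, since 2c + 1 > c.
  incomparableY fzero        (fsuc fzero) _   sub = 1+n≰n (≤-trans (m≤m+n (suc c) c) last≤c)
    where
    first : Edge B fzero yFirst
    first = interval→edge (subst (Interval c 0) (sym (toℕ-yAt 0 z≤n)) (z≤n , z≤n))
    last≤c : suc c + c ≤ c
    last≤c = subst (_≤ c) (toℕ-yAt (suc c + c) ≤-refl) (proj₂ (edge→interval (sub fzero first)))
  -- x_{c+1} sees y_{2c+1} but not y_0, since c + 1 > 0.
  incomparableY (fsuc fzero) fzero        _   sub = 1+n≰n {0} (≤-trans (s≤s z≤n) 1+c≤0)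
    where
    last : Edge B xLast yLast
    last = interval→edge (subst₂ (Interval c) (sym (toℕ-fromℕ (suc c))) (sym (toℕ-yAt (suc c + c) ≤-refl))
                            (m≤m+n (suc c) c , ≤-refl))
    1+c≤0 : suc c ≤ 0
    1+c≤0 = subst₂ _≤_ (toℕ-fromℕ (suc c)) (toℕ-yAt 0 z≤n) (proj₁ (edge→interval (sub xLast last)))

  nablaY : NablaY B 2
  nablaY = (extremeY , incomparableY) , comparableTriples⇒≤2 comparableTriplesY

corollary7 : (k : ℕ) → 2 ≤ k → ACB (Bk k) × NablaX (Bk k) k × NablaY (Bk k) 2
corollary7 (suc (suc c)) _ = narrowY⇒ACB (Bk _) (proj₂ nablaY) , nablaX , nablaY
  where open IntervalGraph c
corollary7 (suc zero) (s≤s ())
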